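{- Let $V$ be an $n$-dimensional vector space over the finite field $\mathbb{F}_q$, let $k$ be a positive integer with $k\le n/2$, and let $\mathcal{S}^*$ be a family of $s$ subspaces of $V$ of codimension $k$. Assume $s\ge 2$ and that there is an integer $d\ge 2$ such that (1) for every $v\in V\setminus\{0\}$, $|\{M\in\mathcal{S}^*: v\in M\}|\in\{0,d\}$, and both values occur; and (2) for all distinct $M,M^*\in\mathcal{S}^*$, $\dim(M\cap M^*)=n-2k$. Let $Y=V$, let $Z=\bigcup_{M\in\mathcal{S}^*}V/M$ (the set of all cosets $b+M$ with $b\in V$, $M\in\mathcal{S}^*$), and let $G$ be the bipartite graph on $Y\cup Z$ in which $v\in Y$ is adjacent to $B\in Z$ iff $v\in B$. Then $G$ is distance-biregular with intersection array \[ \begin{vmatrix} s; & 1, & d, & q^{n-2k}(s-1)/d, & s\\ q^{n-k}; & 1, & q^{n-2k}, & s-1, & q^{n-k}\end{vmatrix}. \]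
   Context: A bipartite graph with bipartition $Y\cup Z$ is distance-biregular if for every vertex $a$, every $i$, and every vertex $w$ at distance $i$ from $a$, the numbers $c_i(a)=|\{u\sim w: d(a,u)=i-1\}|$ and $b_i(a)=|\{u\sim w: d(a,u)=i+1\}|$ depend only on $i$ and on which part contains $a$; write $c_i^Y$, $c_i^Z$ for these numbers. The intersection array $\begin{vmatrix} k; & c_1^{Y}, & \dots, & c_{d_Y}^{Y} \\ \ell; & c_1^{Z}, & \dots, & c_{d_Z}^{Z}\end{vmatrix}$ records the valency $k$ of vertices of $Y$, the valency $\ell$ of vertices of $Z$, and the numbers $c_i^Y$ ($1\le i\le d_Y$), $c_i^Z$ ($1\le i\le d_Z$), where $d_Y,d_Z$ are the eccentricities of vertices in $Y$, $Z$ respectively. -}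

module Defs where

open import Data.Nat using (ℕ; zero; suc; _∸_)
open import Data.Fin using (Fin; toℕ)
open import Data.Fin.Properties using () renaming (_≟_ to _≟F_)
open import Data.Vec using (Vec; []; _∷_; zipWith; replicate; map; foldr)
open import Data.Vec.Properties using (≡-dec)
open import Data.List as L using (List; allFin; concatMap; filterᵇ; length)
open import Data.Bool.ListAction using (any)
open import Data.Bool using (Bool; true; false; _∧_; _∨_; not)
open import Data.Sum using (_⊎_; inj₁; inj₂)
open import Data.Product using (Σ; ∃; _×_; _,_; proj₁; proj₂)
open import Relation.Nullary using (¬_; does)
open import Relation.Binary.PropositionalEquality using (_≡_; _≢_)
open import Algebra.Structures using (IsCommutativeRing)

-- The finite field F_q, realised as a field structure on Fin q
-- (every field with q elements is isomorphic to one of these).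

record FiniteField (q : ℕ) : Set where
  infixl 6 _+_
  infixl 7 _*_
  field
    _+_ _*_ : Fin q → Fin q → Fin q
    -_      : Fin q → Fin q
    0# 1#   : Fin q
    isCommutativeRing : IsCommutativeRing _≡_ _+_ _*_ -_ 0# 1#
    0≢1     : 0# ≢ 1#
    inverse : ∀ x → x ≢ 0# → Σ (Fin q) (λ y → x * y ≡ 1#)

module _ {q : ℕ} (F : FiniteField q) where
  open FiniteField F

  Vect : ℕ → Set
  Vect n = Vec (Fin q) n

  0v : ∀ {n} → Vect n
  0v = replicate _ 0#

  _⊕_ : ∀ {n} → Vect n → Vect n → Vect n
  _⊕_ = zipWith _+_

  _⊝_ : ∀ {n} → Vect n → Vect n → Vect n
  u ⊝ v = zipWith (λ a b → a + (- b)) u v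

  _·_ : ∀ {n} → Fin q → Vect n → Vect n
  c · v = map (c *_) v

  lincomb : ∀ {n m} → Vec (Vect n) m → Vec (Fin q) m → Vect n
  lincomb []       []       = 0v
  lincomb (b ∷ bs) (c ∷ cs) = (c · b) ⊕ lincomb bs cs

  _∈ₛ_ : ∀ {n} → Vect n → (Vect n → Bool) → Set
  v ∈ₛ M = M v ≡ true

  IsSubspace : ∀ {n} → (Vect n → Bool) → Set
  IsSubspace M =
    (0v ∈ₛ M)
    × (∀ u v → u ∈ₛ M → v ∈ₛ M → (u ⊕ v) ∈ₛ M)
    × (∀ c v → v ∈ₛ M → (c · v) ∈ₛ M)

  IsBasis : ∀ {n m} → (Vect n → Bool) → Vec (Vect n) m → Set
  IsBasis M bs =
    (∀ cs → lincomb bs cs ∈ₛ M)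
    × (∀ v → v ∈ₛ M → Σ _ (λ cs → lincomb bs cs ≡ v))
    × (∀ cs → lincomb bs cs ≡ 0v → cs ≡ replicate _ 0#)

  HasDim : ∀ {n} → (Vect n → Bool) → ℕ → Set
  HasDim {n} M m = IsSubspace M × Σ (Vec (Vect n) m) (IsBasis M)

  _∩ₛ_ : ∀ {n} → (Vect n → Bool) → (Vect n → Bool) → (Vect n → Bool)
  (M ∩ₛ N) v = M v ∧ N v

  allVecs : ∀ n → List (Vect n)
  allVecs zero    = L.[ [] ]
  allVecs (suc n) = concatMap (λ x → L.map (x ∷_) (allVecs n)) (allFin q)

  _≟V_ : ∀ {n} → (u v : Vect n) → _
  _≟V_ = ≡-dec _≟F_

  countContaining : ∀ {n s} → (Fin s → Vect n → Bool) → Vect n → ℕ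
  countContaining {s = s} Ms v = length (filterᵇ (λ i → Ms i v) (allFin s))

-- Finite bipartite graphs with bipartition Y ∪ Z, given by a decidable
-- vertex equality and, for each vertex, the list of its neighbours
-- (one representative per neighbouring vertex).

record BipGraph : Set₁ where
  field
    Y Z  : Set
    eqV  : Y ⊎ Z → Y ⊎ Z → Bool
    nbrs : Y ⊎ Z → List (Y ⊎ Z)

module _ (G : BipGraph) where
  open BipGraph G

  Vtx : Set
  Vtx = Y ⊎ Z

  within : ℕ → Vtx → Vtx → Bool
  within zero    a w = eqV a w
  within (suc i) a w = within i a w ∨ any (within i a) (nbrs w)

  distIs : Vtx → Vtx → ℕ → Bool
  distIs a w zero    = eqV a w
  distIs a w (suc i) = within (suc i) a w ∧ not (within i a w)

  deg : Vtx → ℕ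
  deg w = length (nbrs w)

  cnt : Vtx → Vtx → ℕ → ℕ
  cnt a w i = length (filterᵇ (λ u → distIs a u (i ∸ 1)) (nbrs w))

  bnt : Vtx → Vtx → ℕ → ℕ
  bnt a w i = length (filterᵇ (λ u → distIs a u (suc i)) (nbrs w))

  -- the parameters attached to the vertices of one part P of the graph
  -- (embedded into Vtx by ι): every a in P has eccentricity dP, and for
  -- every i and every w at distance i from a, c_i(a) and b_i(a) depend
  -- only on i; the c_i (1 ≤ i ≤ dP) are the entries of cP.
  PartArray : {P : Set} → (P → Vtx) → (dP : ℕ) → Vec ℕ dP → Set
  PartArray ι dP cP =
    (∀ a w → within dP (ι a) w ≡ true)
    × (∀ a → Σ Vtx (λ w → distIs (ι a) w dP ≡ true))
    × (∀ a w (i : Fin dP) → distIs (ι a) w (suc (toℕ i)) ≡ true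
         → cnt (ι a) w (suc (toℕ i)) ≡ Data.Vec.lookup cP i)
    × Σ (ℕ → ℕ) (λ bP → ∀ a w i → distIs (ι a) w i ≡ true
         → bnt (ι a) w i ≡ bP i)

  -- G is distance-biregular with intersection array
  --   | k ; cY_1 … cY_dY |
  --   | ℓ ; cZ_1 … cZ_dZ |
  DistanceBiregularWithArray :
    (k : ℕ) {dY : ℕ} → Vec ℕ dY → (ℓ : ℕ) {dZ : ℕ} → Vec ℕ dZ → Set
  DistanceBiregularWithArray k {dY} cY ℓ {dZ} cZ =
    (∀ y → deg (inj₁ y) ≡ k)
    × (∀ z → deg (inj₂ z) ≡ ℓ)
    × PartArray inj₁ dY cY
    × PartArray inj₂ dZ cZ

-- The coset graph: Y = V, Z = ⋃_{M ∈ S*} V/M, where a coset b + M_i is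
-- represented by the pair (i , b); (i , b) and (j , c) denote the same
-- coset iff i = j and b - c ∈ M_i.  v ∈ Y is adjacent to b + M_i iff
-- v ∈ b + M_i, i.e. v - b ∈ M_i.

module _ {q : ℕ} (F : FiniteField q) where

  cosetGraph : (n s : ℕ) → (Fin s → Vect F n → Bool) → BipGraph
  cosetGraph n s Ms = record
    { Y    = Vect F n
    ; Z    = Fin s × Vect F n
    ; eqV  = eqV
    ; nbrs = nbrs
    }
    where
    eqV : Vect F n ⊎ (Fin s × Vect F n) → Vect F n ⊎ (Fin s × Vect F n) → Bool
    eqV (inj₁ u) (inj₁ v) = does (_≟V_ F u v)
    eqV (inj₁ _) (inj₂ _) = false
    eqV (inj₂ _) (inj₁ _) = false
    eqV (inj₂ (i , b)) (inj₂ (j , c)) = does (i ≟F j) ∧ Ms i (_⊝_ F b c)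
    nbrs : Vect F n ⊎ (Fin s × Vect F n) → List (Vect F n ⊎ (Fin s × Vect F n))
    nbrs (inj₁ v) = L.map (λ i → inj₂ (i , v)) (allFin s)
    nbrs (inj₂ (i , b)) =
      L.map inj₁ (filterᵇ (λ u → Ms i (_⊝_ F u b)) (allVecs F n))

module Submission where

-- The graph distance is given by an explicit function D: for vectors, D v u is 0, 2 or 4
-- according as u = v, u − v lies in some Mᵢ, or neither; a vector is at distance 1 or 3
-- from a coset according as it lies in it or not; two cosets of the same Mᵢ are at distance
-- 0 or 4, and cosets of distinct Mᵢ, Mⱼ are at distance 2 because they always meet, as
-- Mᵢ + Mⱼ = V follows by double counting from |Mᵢ| |Mⱼ| = |Mᵢ ∩ Mⱼ| qⁿ. A function that
-- vanishes exactly on the diagonal, changes by one along every edge and decreases along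
-- some edge out of every other vertex is the distance. Each intersection number then counts
-- the points of a coset, of the intersection of two cosets, the members Mᵢ containing a
-- nonzero vector, or the cosets through a point; only c₃ needs a double count, of the pairs
-- (x, i) with x in a coset avoiding v and x − v ∈ Mᵢ, which gives d c₃ = q^(n−2k) (s − 1).

open import Defs hiding (_⊕_; _⊝_; _·_)
import Defs
open import Level using (0ℓ)
open import Algebra.Bundles using (CommutativeRing; AbelianGroup)
open import Algebra.Structures using (IsCommutativeRing)
open import Data.Bool using (Bool; true; false; _∧_; _∨_; not; if_then_else_)
open import Data.Bool.ListAction using (any; or)
open import Data.Bool.Properties using (T?; T-≡; ⇔→≡; ∧-identityʳ; ∧-zeroʳ; ∨-zeroʳ)
open import Data.Fin using (Fin; toℕ; fromℕ<) renaming (zero to fzero; suc to fsuc)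
open import Data.Fin.Properties using (toℕ-fromℕ<) renaming (_≟_ to _≟ᶠ_)
open import Data.List
  using (List; []; _∷_; _++_; length; map; filterᵇ; allFin; concatMap; cartesianProductWith)
open import Data.List.Membership.Propositional using (_∈_)
open import Data.List.Membership.Propositional.Properties
  using (∈-map⁺; ∈-map⁻; ∈-filter⁺; ∈-filter⁻; ∈-allFin; ∈-cartesianProductWith⁺)
open import Data.List.Membership.Propositional.Properties.WithK using (unique∧set⇒bag)
open import Data.List.Properties using (length-filter; length-map; length-++; length-tabulate)
import Data.List.Properties as List
open import Data.List.Relation.Binary.BagAndSetEquality using (∼bag⇒↭)
open import Data.List.Relation.Binary.Permutation.Propositional.Properties using (↭-length)
import Data.List.Relation.Unary.All as All
open import Data.List.Relation.Unary.AllPairs using ([]; _∷_)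
open import Data.List.Relation.Unary.Any using (here; there)
open import Data.List.Relation.Unary.Unique.Propositional using (Unique)
import Data.List.Relation.Unary.Unique.Propositional.Properties as Unique
open import Data.Nat
  using ( ℕ; zero; suc; _+_; _*_; _∸_; _^_; _≤_; _≟_; _≤?_; _≡ᵇ_; z≤n; s≤s; s≤s⁻¹
        ; parity; ≢-nonZero )
open import Data.Nat.ListAction using (sum)
open import Data.Nat.Properties
  using ( ≤-refl; ≤-trans; ≤-reflexive; n≤1+n; m≤n⇒m≤1+n; m<n⇒m<1+n; ≤∧≢⇒<; <⇒≢; <⇒≱; 1+n≰n
        ; 0≢1+n; suc-injective; m∸n≤m; m+n∸n≡m; m+n∸m≡n; m≤n⇒∃[o]m+o≡n
        ; *-zeroʳ; *-identityˡ; *-suc; *-comm; *-cancelˡ-≡; ^-distribˡ-+-*; +-suc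
        ; +-commutativeSemigroup )
open import Algebra.Properties.CommutativeSemigroup +-commutativeSemigroup
  using () renaming (interchange to +-interchange)
open import Data.Nat.Solver using (module +-*-Solver)
open import Data.Parity.Base as ℙ using (Parity; 0ℙ; 1ℙ)
open import Data.Product using (Σ; ∃; _×_; _,_; proj₁; proj₂)
open import Data.Sum using (_⊎_; inj₁; inj₂)
open import Data.Vec using (Vec; []; _∷_; replicate; lookup)
import Data.Vec as Vec
open import Data.Vec.Properties
  using ( ∷-injective; zipWith-map₂; map-cong; zipWith-assoc; zipWith-comm
        ; zipWith-identityˡ; zipWith-identityʳ; zipWith-inverseˡ; zipWith-inverseʳ )
open import Function.Base using (id)
open import Function.Bundles using (_⇔_; mk⇔; Equivalence)
open import Relation.Binary.Definitions using (DecidableEquality)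
open import Relation.Binary.PropositionalEquality
open import Relation.Nullary using (¬_; does; yes; no; contradiction)
open import Relation.Nullary.Decidable using (dec-true; dec-false)

-- Booleans, lists and counting

∧≡true⇒ : ∀ {a b} → a ∧ b ≡ true → a ≡ true × b ≡ true
∧≡true⇒ {true} b≡true = refl , b≡true

if-preserves : ∀ {A : Set} (P : A → Set) b {x y} → P x → P y → P (if b then x else y)
if-preserves P true  px _  = px
if-preserves P false _  py = py

∈-filterᵇ⁺ : ∀ {A : Set} (p : A → Bool) {xs x} → x ∈ xs → p x ≡ true → x ∈ filterᵇ p xs
∈-filterᵇ⁺ p x∈ px = ∈-filter⁺ (λ x → T? (p x)) x∈ (Equivalence.from T-≡ px)

∈-filterᵇ⁻ : ∀ {A : Set} (p : A → Bool) {xs x} → x ∈ filterᵇ p xs → x ∈ xs × p x ≡ true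
∈-filterᵇ⁻ p {xs} x∈ with ∈-filter⁻ (λ x → T? (p x)) {xs = xs} x∈
... | x∈xs , px = x∈xs , Equivalence.to T-≡ px

filterᵇ⁺-unique : ∀ {A : Set} (p : A → Bool) {xs} → Unique xs → Unique (filterᵇ p xs)
filterᵇ⁺-unique p {xs} = Unique.filter⁺ (λ x → T? (p x)) {xs}

length-cartesianProductWith : ∀ {A B C : Set} (f : A → B → C) xs ys →
                              length (cartesianProductWith f xs ys) ≡ length xs * length ys
length-cartesianProductWith f []       ys = refl
length-cartesianProductWith f (x ∷ xs) ys =
  trans (length-++ (map (f x) ys))
        (cong₂ _+_ (length-map (f x) ys) (length-cartesianProductWith f xs ys))

count : {A : Set} → (A → Bool) → List A → ℕ
count p xs = length (filterᵇ p xs)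

module _ {A : Set} where

  count-∷ : ∀ (p : A → Bool) x xs →
            count p (x ∷ xs) ≡ (if p x then 1 else 0) + count p xs
  count-∷ p x xs with p x
  ... | true  = refl
  ... | false = refl

  count-cong : ∀ {p p′ : A → Bool} xs → (∀ x → x ∈ xs → p x ≡ p′ x) →
               count p xs ≡ count p′ xs
  count-cong []       _  = refl
  count-cong {p} {p′} (x ∷ xs) eq = begin
    count p (x ∷ xs)                       ≡⟨ count-∷ p x xs ⟩
    (if p x then 1 else 0) + count p xs    ≡⟨ cong₂ (λ b n → (if b then 1 else 0) + n)
                                                    (eq x (here refl))
                                                    (count-cong xs (λ y y∈ → eq y (there y∈))) ⟩
    (if p′ x then 1 else 0) + count p′ xs  ≡⟨ count-∷ p′ x xs ⟨
    count p′ (x ∷ xs)                      ∎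
    where open ≡-Reasoning

  count-map : ∀ {B : Set} (p : B → Bool) (f : A → B) xs →
              count p (map f xs) ≡ count (λ x → p (f x)) xs
  count-map p f []       = refl
  count-map p f (x ∷ xs) with p (f x)
  ... | true  = cong suc (count-map p f xs)
  ... | false = count-map p f xs

  count-filterᵇ : ∀ (p q : A → Bool) xs →
                  count p (filterᵇ q xs) ≡ count (λ x → q x ∧ p x) xs
  count-filterᵇ p q []       = refl
  count-filterᵇ p q (x ∷ xs) with q x
  ... | false = count-filterᵇ p q xs
  ... | true with p x
  ...   | true  = cong suc (count-filterᵇ p q xs)
  ...   | false = count-filterᵇ p q xs

  count≡0 : ∀ (p : A → Bool) xs → (∀ x → x ∈ xs → p x ≡ false) → count p xs ≡ 0
  count≡0 p []       _   = refl
  count≡0 p (x ∷ xs) off with p x in px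
  ... | true  = contradiction (trans (sym px) (off x (here refl))) λ ()
  ... | false = count≡0 p xs (λ y y∈ → off y (there y∈))

  count≢0 : ∀ (p : A → Bool) {xs x} → x ∈ xs → p x ≡ true → count p xs ≢ 0
  count≢0 p {y ∷ ys} (here refl) px rewrite count-∷ p y ys | px = λ ()
  count≢0 p {y ∷ ys} (there x∈)  px rewrite count-∷ p y ys with p y
  ... | true  = λ ()
  ... | false = count≢0 p x∈ px

  count≡0⇒ : ∀ (p : A → Bool) {xs x} → count p xs ≡ 0 → x ∈ xs → p x ≡ false
  count≡0⇒ p {x = x} none x∈ with p x in px
  ... | false = refl
  ... | true  = contradiction none (count≢0 p x∈ px)

  count≢0⇒witness : ∀ (p : A → Bool) xs → count p xs ≢ 0 → ∃ λ x → x ∈ xs × p x ≡ true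
  count≢0⇒witness p []       ≢0 = contradiction refl ≢0
  count≢0⇒witness p (x ∷ xs) ≢0 with p x in px
  ... | true  = x , here refl , px
  ... | false with count≢0⇒witness p xs ≢0
  ...   | y , y∈ , py = y , there y∈ , py

  count-partition : ∀ (p p′ : A → Bool) xs → (∀ x → x ∈ xs → p x ≡ not (p′ x)) →
                    count p xs + count p′ xs ≡ length xs
  count-partition p p′ []       _   = refl
  count-partition p p′ (x ∷ xs) opp
    with rest ← count-partition p p′ xs (λ y y∈ → opp y (there y∈))
       | p x | p′ x | opp x (here refl)
  ... | true  | false | _ = cong suc rest
  ... | false | true  | _ = trans (+-suc _ _) (cong suc rest)

  count-≟≡1 : (_≟_ : DecidableEquality A) {xs : List A} {x : A} → Unique xs → x ∈ xs →
              count (λ y → does (x ≟ y)) xs ≡ 1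
  count-≟≡1 _≟_ {y ∷ ys} {x} (y∉ys ∷ !ys) (here refl) with x ≟ x
  ... | no x≢x = contradiction refl x≢x
  ... | yes _  =
    cong suc (count≡0 _ ys λ z z∈ → dec-false (x ≟ z) λ { refl → All.lookup y∉ys z∈ refl })
  count-≟≡1 _≟_ {y ∷ ys} {x} (y∉ys ∷ !ys) (there x∈) with x ≟ y
  ... | yes refl = contradiction refl (All.lookup y∉ys x∈)
  ... | no _     = count-≟≡1 _≟_ !ys x∈

  count≡length⇒ : ∀ (p : A → Bool) {xs x} → count p xs ≡ length xs → x ∈ xs → p x ≡ true
  count≡length⇒ p {y ∷ ys} full x∈ with p y in py
  count≡length⇒ p {y ∷ ys} full (here refl) | true = py
  count≡length⇒ p {y ∷ ys} full (there x∈)  | true = count≡length⇒ p (suc-injective full) x∈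
  ... | false = contradiction full (<⇒≢ (s≤s (length-filter (λ x → T? (p x)) ys)))

  sum-map-if : ∀ (f : A → ℕ) (p : A → Bool) K xs →
               (∀ x → x ∈ xs → f x ≡ (if p x then K else 0)) →
               sum (map f xs) ≡ K * count p xs
  sum-map-if f p K []       _  = sym (*-zeroʳ K)
  sum-map-if f p K (x ∷ xs) f≡
    with ih ← sum-map-if f p K xs (λ y y∈ → f≡ y (there y∈)) | p x | f≡ x (here refl)
  ... | true  | fx≡K = trans (cong₂ _+_ fx≡K ih) (sym (*-suc K _))
  ... | false | fx≡0 = cong₂ _+_ fx≡0 ih

  count≡sum : ∀ (p : A → Bool) xs → count p xs ≡ sum (map (λ x → if p x then 1 else 0) xs)
  count≡sum p xs = sym (trans (sum-map-if _ p 1 xs (λ _ _ → refl)) (*-identityˡ _))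

  sum-map-+ : ∀ (f g : A → ℕ) xs →
              sum (map (λ x → f x + g x) xs) ≡ sum (map f xs) + sum (map g xs)
  sum-map-+ f g []       = refl
  sum-map-+ f g (x ∷ xs) = trans (cong (f x + g x +_) (sum-map-+ f g xs))
                                 (+-interchange (f x) (g x) _ _)

  any-∈ : ∀ (p : A → Bool) {xs x} → x ∈ xs → p x ≡ true → any p xs ≡ true
  any-∈ p {x ∷ xs} (here refl) px = cong (_∨ any p xs) px
  any-∈ p {y ∷ _} (there x∈) px = trans (cong (p y ∨_) (any-∈ p x∈ px)) (∨-zeroʳ (p y))

  any⇒∃ : ∀ (p : A → Bool) xs → any p xs ≡ true → ∃ λ x → x ∈ xs × p x ≡ true
  any⇒∃ p (x ∷ xs) some with p x in px
  ... | true  = x , here refl , px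
  ... | false with any⇒∃ p xs some
  ...   | y , y∈ , py = y , there y∈ , py

  any≡false⇒ : ∀ (p : A → Bool) {xs x} → any p xs ≡ false → x ∈ xs → p x ≡ false
  any≡false⇒ p {x = x} none x∈ with p x in px
  ... | false = refl
  ... | true  = contradiction (trans (sym (any-∈ p x∈ px)) none) λ ()

  any≡false⇐ : ∀ (p : A → Bool) xs → (∀ x → x ∈ xs → p x ≡ false) → any p xs ≡ false
  any≡false⇐ p []       _    = refl
  any≡false⇐ p (x ∷ xs) none =
    cong₂ _∨_ (none x (here refl)) (any≡false⇐ p xs (λ y y∈ → none y (there y∈)))

  same-elements⇒length≡ : ∀ {xs ys : List A} → Unique xs → Unique ys →
                          (∀ {z} → z ∈ xs ⇔ z ∈ ys) → length xs ≡ length ys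
  same-elements⇒length≡ !xs !ys xs≈ys = ↭-length (∼bag⇒↭ (unique∧set⇒bag !xs !ys xs≈ys))

sum-swap : ∀ {A B : Set} (r : A → B → Bool) xs ys →
           sum (map (λ x → count (r x) ys) xs) ≡ sum (map (λ y → count (λ x → r x y) xs) ys)
sum-swap r []       ys = sym (sum-zeros ys)
  where
  sum-zeros : ∀ ys → sum (map (λ y → count (λ x → r x y) []) ys) ≡ 0
  sum-zeros []       = refl
  sum-zeros (_ ∷ ys) = sum-zeros ys
sum-swap r (x ∷ xs) ys = begin
  count (r x) ys + sum (map (λ x′ → count (r x′) ys) xs)
    ≡⟨ cong₂ _+_ (count≡sum (r x) ys) (sum-swap r xs ys) ⟩
  sum (map (λ y → if r x y then 1 else 0) ys) + sum (map (λ y → count (λ x′ → r x′ y) xs) ys)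
    ≡⟨ sum-map-+ _ _ ys ⟨
  sum (map (λ y → (if r x y then 1 else 0) + count (λ x′ → r x′ y) xs) ys)
    ≡⟨ cong sum (List.map-cong (λ y → count-∷ (λ x′ → r x′ y) x xs) ys) ⟨
  sum (map (λ y → count (λ x′ → r x′ y) (x ∷ xs)) ys) ∎
  where open ≡-Reasoning

-- Distance functions of bipartite graphs

lookup₀ : ∀ {m} → Vec ℕ m → ℕ → ℕ
lookup₀ []       _       = 0
lookup₀ (x ∷ xs) zero    = x
lookup₀ (x ∷ xs) (suc j) = lookup₀ xs j

lookup₀-toℕ : ∀ {m} (xs : Vec ℕ m) i → lookup₀ xs (toℕ i) ≡ lookup xs i
lookup₀-toℕ (x ∷ xs) fzero    = refl
lookup₀-toℕ (x ∷ xs) (fsuc i) = lookup₀-toℕ xs i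

OneApart : ℕ → ℕ → Set
OneApart m n = m ≡ suc n ⊎ suc m ≡ n

OneApart-sym : ∀ {m n} → OneApart m n → OneApart n m
OneApart-sym (inj₁ m≡1+n) = inj₂ (sym m≡1+n)
OneApart-sym (inj₂ 1+m≡n) = inj₁ (sym 1+m≡n)

≟-adjacent : ∀ m n → OneApart m n → does (m ≟ suc n) ≡ not (does (m ≟ n ∸ 1))
≟-adjacent m n (inj₁ refl) =
  trans (dec-true (m ≟ m) refl)
        (cong not (sym (dec-false (m ≟ n ∸ 1) λ eq → <⇒≱ (s≤s (m∸n≤m n 1)) (≤-reflexive eq))))
≟-adjacent m n (inj₂ refl) =
  trans (dec-false (m ≟ suc (suc m)) (λ eq → <⇒≢ (m<n⇒m<1+n ≤-refl) eq))
        (cong not (sym (dec-true (m ≟ m) refl)))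

-- does (m ≟ n) and does (m ≤? n) compute to m ≡ᵇ n and m ≤ᵇ n, so abstracting the decision
-- with `with` leaves the goal untouched; the proofs below rewrite with dec-true/dec-false.
≤?-shell : ∀ m i → does (m ≤? suc i) ∧ not (does (m ≤? i)) ≡ does (m ≟ suc i)
≤?-shell m i with m ≟ suc i
... | yes refl
  rewrite dec-true (m ≤? m) ≤-refl | dec-false (m ≤? i) 1+n≰n | dec-true (m ≟ m) refl = refl
... | no m≢si rewrite dec-false (m ≟ suc i) m≢si with m ≤? i
...   | yes m≤i rewrite dec-true (m ≤? i) m≤i = ∧-zeroʳ _
...   | no m≰i
  rewrite dec-false (m ≤? suc i) (λ m≤si → m≰i (s≤s⁻¹ (≤∧≢⇒< m≤si m≢si))) = refl

if-≟ : ∀ b {m n} → m ≢ n → does ((if b then m else n) ≟ m) ≡ b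
if-≟ true  {m} _   = dec-true (m ≟ m) refl
if-≟ false {m} {n} m≢n = dec-false (n ≟ m) (λ n≡m → m≢n (sym n≡m))

module DistanceFunction
  (G : BipGraph) (D : Vtx G → Vtx G → ℕ)
  (D≡0 : ∀ a w → BipGraph.eqV G a w ≡ does (D a w ≟ 0))
  (D-step : ∀ a w u → u ∈ BipGraph.nbrs G w → OneApart (D a u) (D a w))
  (D-descent : ∀ a w → D a w ≢ 0 → ∃ λ u → u ∈ BipGraph.nbrs G w × suc (D a u) ≡ D a w)
  where

  open BipGraph G using (nbrs)

  D-lipschitz : ∀ a w u → u ∈ nbrs w → D a w ≤ suc (D a u)
  D-lipschitz a w u u∈ with D-step a w u u∈
  ... | inj₁ up   = ≤-trans (m≤n⇒m≤1+n (n≤1+n _)) (≤-reflexive (cong suc (sym up)))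
  ... | inj₂ down = ≤-reflexive (sym down)

  within-suc : ∀ i a w →
    does (D a w ≤? i) ∨ any (λ u → does (D a u ≤? i)) (nbrs w) ≡ does (D a w ≤? suc i)
  within-suc i a w with D a w ≤? i
  ... | yes ≤i
    rewrite dec-true (D a w ≤? i) ≤i | dec-true (D a w ≤? suc i) (m≤n⇒m≤1+n ≤i) = refl
  ... | no ≰i rewrite dec-false (D a w ≤? i) ≰i with D a w ≟ suc i
  ...   | no ≢si
    rewrite dec-false (D a w ≤? suc i) (λ ≤si → ≰i (s≤s⁻¹ (≤∧≢⇒< ≤si ≢si))) =
    any≡false⇐ _ (nbrs w) (λ u u∈ → dec-false (D a u ≤? i) (too-far u u∈))
    where
    too-far : ∀ u → u ∈ nbrs w → ¬ D a u ≤ i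
    too-far u u∈ ≤i = ≰i (s≤s⁻¹ (≤∧≢⇒< (≤-trans (D-lipschitz a w u u∈) (s≤s ≤i)) ≢si))
  ...   | yes ≡si rewrite dec-true (D a w ≤? suc i) (≤-reflexive ≡si)
    with D-descent a w (λ ≡0 → 0≢1+n (trans (sym ≡0) ≡si))
  ...     | u , u∈ , down =
    any-∈ _ u∈ (dec-true (D a u ≤? i) (s≤s⁻¹ (≤-reflexive (trans down ≡si))))

  within≡ : ∀ i a w → within G i a w ≡ does (D a w ≤? i)
  within≡ zero    a w = trans (D≡0 a w) (≟0≡≤?0 (D a w))
    where
    ≟0≡≤?0 : ∀ m → does (m ≟ 0) ≡ does (m ≤? 0)
    ≟0≡≤?0 zero    = refl
    ≟0≡≤?0 (suc m) = refl
  within≡ (suc i) a w =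
    trans (cong₂ _∨_ (within≡ i a w) (cong or (List.map-cong (within≡ i a) (nbrs w))))
          (within-suc i a w)

  distIs≡ : ∀ a w i → distIs G a w i ≡ does (D a w ≟ i)
  distIs≡ a w zero    = D≡0 a w
  distIs≡ a w (suc i) =
    trans (cong₂ (λ x y → x ∧ not y) (within≡ (suc i) a w) (within≡ i a w))
          (≤?-shell (D a w) i)

  distIs⇒D≡ : ∀ {a w i} → distIs G a w i ≡ true → D a w ≡ i
  distIs⇒D≡ {a} {w} {i} at with D a w ≟ i
  ... | yes eq = eq
  ... | no ≢i  =
    contradiction (trans (sym at) (trans (distIs≡ a w i) (dec-false (D a w ≟ i) ≢i))) λ ()

  D≡⇒distIs : ∀ {a w i} → D a w ≡ i → distIs G a w i ≡ true
  D≡⇒distIs {a} {w} {i} eq = trans (distIs≡ a w i) (dec-true (D a w ≟ i) eq)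

  cnt≡ : ∀ a w i → cnt G a w i ≡ count (λ u → does (D a u ≟ i ∸ 1)) (nbrs w)
  cnt≡ a w i = count-cong (nbrs w) (λ u _ → distIs≡ a u (i ∸ 1))

  bnt+cnt≡deg : ∀ {a w i} → D a w ≡ i → bnt G a w i + cnt G a w i ≡ deg G w
  bnt+cnt≡deg {a} {w} {i} refl =
    trans (cong₂ _+_ (count-cong (nbrs w) (λ u _ → distIs≡ a u (suc i))) (cnt≡ a w i))
          (count-partition _ _ (nbrs w) λ u u∈ → ≟-adjacent (D a u) i (D-step a w u u∈))

  cnt-at-0 : ∀ {a w} → D a w ≡ 0 → cnt G a w 0 ≡ 0
  cnt-at-0 {a} {w} ≡0 =
    trans (cnt≡ a w 0) (count≡0 _ (nbrs w) λ u u∈ → dec-false (D a u ≟ 0) (≢0 u u∈))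
    where
    ≢0 : ∀ u → u ∈ nbrs w → D a u ≢ 0
    ≢0 u u∈ u≡0 with D-step a w u u∈
    ... | inj₁ up   = 0≢1+n (trans (sym u≡0) up)
    ... | inj₂ down = 0≢1+n (trans (sym ≡0) (trans (sym down) (cong suc u≡0)))

  count-at-eccentricity : ∀ a w {e} → (∀ u → D a u ≤ suc e) → D a w ≡ suc e →
                          count (λ u → does (D a u ≟ e)) (nbrs w) ≡ deg G w
  count-at-eccentricity a w {e} bounded far = begin
    count (λ u → does (D a u ≟ e)) (nbrs w)   ≡⟨ cnt≡ a w (suc e) ⟨
    cnt G a w (suc e)                         ≡⟨ cong (_+ cnt G a w (suc e)) bnt≡0 ⟨
    bnt G a w (suc e) + cnt G a w (suc e)     ≡⟨ bnt+cnt≡deg far ⟩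
    deg G w                                   ∎
    where
    open ≡-Reasoning
    bnt≡0 : bnt G a w (suc e) ≡ 0
    bnt≡0 = trans (count-cong (nbrs w) (λ u _ → distIs≡ a u (suc (suc e))))
                  (count≡0 _ (nbrs w) λ u _ → dec-false (D a u ≟ suc (suc e)) λ eq →
                     1+n≰n (≤-trans (≤-reflexive (sym eq)) (bounded u)))

  partArray : ∀ {P : Set} (ι : P → Vtx G) (dP : ℕ) (cP : Vec ℕ dP) (δ : ℕ → ℕ) →
    (∀ a w → D (ι a) w ≤ dP) →
    (∀ a → ∃ λ w → D (ι a) w ≡ dP) →
    (∀ a w → deg G w ≡ δ (D (ι a) w)) →
    (∀ a w (i : Fin dP) → D (ι a) w ≡ suc (toℕ i) →
       count (λ u → does (D (ι a) u ≟ toℕ i)) (nbrs w) ≡ lookup cP i) →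
    PartArray G ι dP cP
  partArray ι dP cP δ bounded attained degree c-values =
      (λ a w → trans (within≡ dP (ι a) w) (dec-true (D (ι a) w ≤? dP) (bounded a w)))
    , (λ a → let w , far = attained a in w , D≡⇒distIs far)
    , (λ a w i at → trans (cnt≡ (ι a) w (suc (toℕ i))) (c-values a w i (distIs⇒D≡ at)))
    , (λ i → δ i ∸ lookup₀ (0 ∷ cP) i) , b-values
    where
    cnt-value : ∀ a w i → D (ι a) w ≡ i → cnt G (ι a) w i ≡ lookup₀ (0 ∷ cP) i
    cnt-value a w zero    at = cnt-at-0 at
    cnt-value a w (suc j) at = begin
      cnt G (ι a) w (suc j)                              ≡⟨ cnt≡ (ι a) w (suc j) ⟩
      count (λ u → does (D (ι a) u ≟ j)) (nbrs w)
        ≡⟨ cong (λ k → count (λ u → does (D (ι a) u ≟ k)) (nbrs w)) toℕi≡j ⟨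
      count (λ u → does (D (ι a) u ≟ toℕ i)) (nbrs w)
        ≡⟨ c-values a w i (trans at (cong suc (sym toℕi≡j))) ⟩
      lookup cP i                                        ≡⟨ lookup₀-toℕ cP i ⟨
      lookup₀ cP (toℕ i)                                 ≡⟨ cong (lookup₀ cP) toℕi≡j ⟩
      lookup₀ cP j                                       ∎
      where
      open ≡-Reasoning
      j<dP = ≤-trans (≤-reflexive (sym at)) (bounded a w)
      i = fromℕ< j<dP
      toℕi≡j = toℕ-fromℕ< j<dP
    b-values : ∀ a w i → distIs G (ι a) w i ≡ true → bnt G (ι a) w i ≡ δ i ∸ lookup₀ (0 ∷ cP) i
    b-values a w i at = begin
      bnt G (ι a) w i                                      ≡⟨ m+n∸n≡m _ (cnt G (ι a) w i) ⟨
      bnt G (ι a) w i + cnt G (ι a) w i ∸ cnt G (ι a) w i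
        ≡⟨ cong₂ _∸_ (bnt+cnt≡deg D≡i) (cnt-value a w i D≡i) ⟩
      deg G w ∸ lookup₀ (0 ∷ cP) i
        ≡⟨ cong (_∸ lookup₀ (0 ∷ cP) i) (trans (degree a w) (cong δ D≡i)) ⟩
      δ i ∸ lookup₀ (0 ∷ cP) i                             ∎
      where
      open ≡-Reasoning
      D≡i = distIs⇒D≡ at

-- Vectors over F

module LinearAlgebra {q : ℕ} (F : FiniteField q) where

  open FiniteField F using (-_; 0#; 1#; isCommutativeRing) renaming (_+_ to _+ᶠ_)
  open IsCommutativeRing isCommutativeRing
    using (+-assoc; +-comm; +-identityˡ; +-identityʳ; -‿inverseˡ; -‿inverseʳ)

  fieldRing : CommutativeRing 0ℓ 0ℓ
  fieldRing = record { isCommutativeRing = isCommutativeRing }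

  open import Algebra.Properties.Ring (CommutativeRing.ring fieldRing)
    using (-1*x≈-x; [y-z]x≈yx-zx)

  private
    variable
      n m : ℕ

  infixl 6 _⊕_ _⊝_
  infixr 7 _·_

  _⊕_ _⊝_ : Vect F n → Vect F n → Vect F n
  _⊕_ = Defs._⊕_ F
  _⊝_ = Defs._⊝_ F

  _·_ : Fin q → Vect F n → Vect F n
  _·_ = Defs._·_ F

  ⊖_ : Vect F n → Vect F n
  ⊖_ = Vec.map -_

  vectorGroup : ℕ → AbelianGroup 0ℓ 0ℓ
  vectorGroup n = record
    { Carrier = Vect F n
    ; _≈_     = _≡_
    ; _∙_     = _⊕_
    ; ε       = 0v F
    ; _⁻¹     = ⊖_
    ; isAbelianGroup = record
      { isGroup = record
        { isMonoid = record
          { isSemigroup = record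
            { isMagma = record { isEquivalence = isEquivalence ; ∙-cong = cong₂ _⊕_ }
            ; assoc   = zipWith-assoc +-assoc
            }
          ; identity = zipWith-identityˡ +-identityˡ , zipWith-identityʳ +-identityʳ
          }
        ; inverse = zipWith-inverseˡ -‿inverseˡ , zipWith-inverseʳ -‿inverseʳ
        ; ⁻¹-cong = cong ⊖_
        }
      ; comm = zipWith-comm +-comm
      }
    }

  module VectorGroup {n : ℕ} where
    open AbelianGroup (vectorGroup n) public using (assoc; identityʳ; inverseʳ)
    open import Algebra.Properties.AbelianGroup (vectorGroup n) public

  open VectorGroup

  ⊝≡⊕⊖ : (u v : Vect F n) → u ⊝ v ≡ u ⊕ ⊖ v
  ⊝≡⊕⊖ u v = sym (zipWith-map₂ _ -_ u v)

  ⊝-self : (u : Vect F n) → u ⊝ u ≡ 0v F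
  ⊝-self u = trans (⊝≡⊕⊖ u u) (inverseʳ u)

  ⊝-identityʳ : (u : Vect F n) → u ⊝ 0v F ≡ u
  ⊝-identityʳ u = trans (⊝≡⊕⊖ u (0v F)) (trans (cong (u ⊕_) ε⁻¹≈ε) (identityʳ u))

  ⊝≡0⇒≡ : (u v : Vect F n) → u ⊝ v ≡ 0v F → u ≡ v
  ⊝≡0⇒≡ u v eq = x∙y⁻¹≈ε⇒x≈y u v (trans (sym (⊝≡⊕⊖ u v)) eq)

  ⊝-anticomm : (u v : Vect F n) → v ⊝ u ≡ (- 1#) · (u ⊝ v)
  ⊝-anticomm u v = begin
    v ⊝ u              ≡⟨ ⊝≡⊕⊖ v u ⟩
    v ⊕ ⊖ u            ≡⟨ ⁻¹-anti-homo‿- u v ⟨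
    ⊖ (u ⊕ ⊖ v)        ≡⟨ cong ⊖_ (⊝≡⊕⊖ u v) ⟨
    ⊖ (u ⊝ v)          ≡⟨ map-cong -1*x≈-x (u ⊝ v) ⟨
    (- 1#) · (u ⊝ v)   ∎
    where open ≡-Reasoning

  ⊝-chain : (u p w : Vect F n) → (u ⊝ p) ⊕ (p ⊝ w) ≡ u ⊝ w
  ⊝-chain u p w = begin
    (u ⊝ p) ⊕ (p ⊝ w)      ≡⟨ cong₂ _⊕_ (⊝≡⊕⊖ u p) (⊝≡⊕⊖ p w) ⟩
    (u ⊕ ⊖ p) ⊕ (p ⊕ ⊖ w)  ≡⟨ assoc u (⊖ p) (p ⊕ ⊖ w) ⟩
    u ⊕ (⊖ p ⊕ (p ⊕ ⊖ w))  ≡⟨ cong (u ⊕_) (\\-leftDividesʳ p (⊖ w)) ⟩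
    u ⊕ ⊖ w                ≡⟨ ⊝≡⊕⊖ u w ⟨
    u ⊝ w                  ∎
    where open ≡-Reasoning

  ⊕⊝-cancelʳ : (u c : Vect F n) → (u ⊕ c) ⊝ c ≡ u
  ⊕⊝-cancelʳ u c = trans (⊝≡⊕⊖ (u ⊕ c) c) (//-rightDividesʳ c u)

  ⊝⊕-cancelʳ : (u c : Vect F n) → (u ⊝ c) ⊕ c ≡ u
  ⊝⊕-cancelʳ u c = trans (cong (_⊕ c) (⊝≡⊕⊖ u c)) (//-rightDividesˡ c u)

  ⊕⊝-cancelˡ : (u x : Vect F n) → (u ⊕ x) ⊝ u ≡ x
  ⊕⊝-cancelˡ u x = trans (⊝≡⊕⊖ (u ⊕ x) u) (xyx⁻¹≈y u x)

  ⊕-⊝-interchange : ∀ {n} (a x b y : Vect F n) → (a ⊕ x) ⊝ (b ⊕ y) ≡ (a ⊝ b) ⊕ (x ⊝ y)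
  ⊕-⊝-interchange {n} a x b y = begin
    (a ⊕ x) ⊝ (b ⊕ y)          ≡⟨ ⊝≡⊕⊖ (a ⊕ x) (b ⊕ y) ⟩
    (a ⊕ x) ⊕ ⊖ (b ⊕ y)        ≡⟨ cong ((a ⊕ x) ⊕_) (⁻¹-∙-comm b y) ⟨
    (a ⊕ x) ⊕ (⊖ b ⊕ ⊖ y)      ≡⟨ interchange a x (⊖ b) (⊖ y) ⟩
    (a ⊕ ⊖ b) ⊕ (x ⊕ ⊖ y)      ≡⟨ cong₂ _⊕_ (⊝≡⊕⊖ a b) (⊝≡⊕⊖ x y) ⟨
    (a ⊝ b) ⊕ (x ⊝ y)          ∎
    where
    open ≡-Reasoning
    open import Algebra.Properties.CommutativeSemigroup
      (AbelianGroup.commutativeSemigroup (vectorGroup n)) using (interchange)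

  ·-distribʳ-⊝ : (c c′ : Fin q) (b : Vect F n) → c · b ⊝ c′ · b ≡ (c +ᶠ - c′) · b
  ·-distribʳ-⊝ c c′ []      = refl
  ·-distribʳ-⊝ c c′ (x ∷ b) = cong₂ _∷_ (sym ([y-z]x≈yx-zx x c c′)) (·-distribʳ-⊝ c c′ b)

  lincomb-⊝ : (bs : Vec (Vect F n) m) (cs cs′ : Vect F m) →
              lincomb F bs cs ⊝ lincomb F bs cs′ ≡ lincomb F bs (cs ⊝ cs′)
  lincomb-⊝ []       []       []         = ⊝-self (0v F)
  lincomb-⊝ (b ∷ bs) (c ∷ cs) (c′ ∷ cs′) =
    trans (⊕-⊝-interchange (c · b) (lincomb F bs cs) (c′ · b) (lincomb F bs cs′))
          (cong₂ _⊕_ (·-distribʳ-⊝ c c′ b) (lincomb-⊝ bs cs cs′))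

  lincomb-injective : (bs : Vec (Vect F n) m) →
    (∀ cs → lincomb F bs cs ≡ 0v F → cs ≡ replicate m 0#) →
    ∀ {cs cs′} → lincomb F bs cs ≡ lincomb F bs cs′ → cs ≡ cs′
  lincomb-injective bs independent {cs} {cs′} eq =
    ⊝≡0⇒≡ cs cs′ (independent (cs ⊝ cs′) difference≡0)
    where
    open ≡-Reasoning
    difference≡0 : lincomb F bs (cs ⊝ cs′) ≡ 0v F
    difference≡0 = begin
      lincomb F bs (cs ⊝ cs′)                 ≡⟨ lincomb-⊝ bs cs cs′ ⟨
      lincomb F bs cs ⊝ lincomb F bs cs′      ≡⟨ cong (_⊝ lincomb F bs cs′) eq ⟩
      lincomb F bs cs′ ⊝ lincomb F bs cs′     ≡⟨ ⊝-self (lincomb F bs cs′) ⟩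
      0v F                                    ∎

  infix 4 _≈[_]_

  _≈[_]_ : Vect F n → (Vect F n → Bool) → Vect F n → Set
  u ≈[ M ] w = M (u ⊝ w) ≡ true

  module Subspace {n} {M : Vect F n → Bool} (M-subspace : IsSubspace F M) where

    private
      0∈M = proj₁ M-subspace
      +-closed = proj₁ (proj₂ M-subspace)
      ·-closed = proj₂ (proj₂ M-subspace)

    ≈-refl : ∀ u → u ≈[ M ] u
    ≈-refl u = subst (λ x → M x ≡ true) (sym (⊝-self u)) 0∈M

    ≈-sym : ∀ {u w} → u ≈[ M ] w → w ≈[ M ] u
    ≈-sym {u} {w} u≈w = subst (λ x → M x ≡ true) (sym (⊝-anticomm u w)) (·-closed _ _ u≈w)

    ≈-trans : ∀ {u p w} → u ≈[ M ] p → p ≈[ M ] w → u ≈[ M ] w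
    ≈-trans {u} {p} {w} u≈p p≈w =
      subst (λ x → M x ≡ true) (⊝-chain u p w) (+-closed _ _ u≈p p≈w)

    ⊝-comm-∈ : ∀ u w → M (u ⊝ w) ≡ M (w ⊝ u)
    ⊝-comm-∈ u w = ⇔→≡ (mk⇔ ≈-sym ≈-sym)

    same-coset : ∀ {p c} → p ≈[ M ] c → ∀ x → M (x ⊝ c) ≡ M (x ⊝ p)
    same-coset p≈c x =
      ⇔→≡ (mk⇔ (λ x≈c → ≈-trans x≈c (≈-sym p≈c)) (λ x≈p → ≈-trans x≈p p≈c))

  allVecs-cartesian : ∀ n → allVecs F (suc n) ≡ cartesianProductWith _∷_ (allFin q) (allVecs F n)
  allVecs-cartesian n = go (allFin q)
    where
    go : ∀ xs → concatMap (λ x → map (x ∷_) (allVecs F n)) xs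
              ≡ cartesianProductWith _∷_ xs (allVecs F n)
    go []       = refl
    go (x ∷ xs) = cong (map (x ∷_) (allVecs F n) ++_) (go xs)

  ∈-allVecs : (v : Vect F n) → v ∈ allVecs F n
  ∈-allVecs []      = here refl
  ∈-allVecs (x ∷ v) = subst ((x ∷ v) ∈_) (sym (allVecs-cartesian _))
    (∈-cartesianProductWith⁺ _∷_ (∈-allFin x) (∈-allVecs v))

  allVecs-unique : ∀ n → Unique (allVecs F n)
  allVecs-unique zero    = All.[] ∷ []
  allVecs-unique (suc n) = subst Unique (sym (allVecs-cartesian n))
    (Unique.cartesianProductWith⁺ _∷_ ∷-injective (Unique.allFin⁺ q) (allVecs-unique n))

  length-allVecs : ∀ n → length (allVecs F n) ≡ q ^ n
  length-allVecs zero    = refl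
  length-allVecs (suc n) = begin
    length (allVecs F (suc n))
      ≡⟨ cong length (allVecs-cartesian n) ⟩
    length (cartesianProductWith _∷_ (allFin q) (allVecs F n))
      ≡⟨ length-cartesianProductWith _∷_ (allFin q) _ ⟩
    length (allFin q) * length (allVecs F n)
      ≡⟨ cong₂ _*_ (length-tabulate {n = q} id) (length-allVecs n) ⟩
    q * q ^ n ∎
    where open ≡-Reasoning

  count≡length-of-image : ∀ {B : Set} (P : Vect F n → Bool) (f : B → Vect F n) (xs : List B) →
    (∀ {x y} → f x ≡ f y → x ≡ y) → Unique xs →
    (∀ v → P v ≡ true → ∃ λ x → x ∈ xs × f x ≡ v) →
    (∀ x → x ∈ xs → P (f x) ≡ true) →
    count P (allVecs F n) ≡ length xs
  count≡length-of-image {n} P f xs f-injective !xs onto into =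
    trans (same-elements⇒length≡ (filterᵇ⁺-unique P (allVecs-unique n))
                                 (Unique.map⁺ f-injective !xs)
                                 (mk⇔ to from))
          (length-map f xs)
    where
    to : ∀ {v} → v ∈ filterᵇ P (allVecs F n) → v ∈ map f xs
    to v∈ with onto _ (proj₂ (∈-filterᵇ⁻ P {allVecs F n} v∈))
    ... | x , x∈ , refl = ∈-map⁺ f x∈
    from : ∀ {v} → v ∈ map f xs → v ∈ filterᵇ P (allVecs F n)
    from v∈ with ∈-map⁻ f v∈
    ... | x , x∈ , refl = ∈-filterᵇ⁺ P (∈-allVecs (f x)) (into x x∈)

  count-translate : (P : Vect F n → Bool) (c : Vect F n) →
                    count (λ u → P (u ⊝ c)) (allVecs F n) ≡ count P (allVecs F n)
  count-translate {n} P c = count≡length-of-image _ (_⊕ c) (filterᵇ P (allVecs F n))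
    (λ {x} {y} eq → trans (sym (⊕⊝-cancelʳ x c)) (trans (cong (_⊝ c) eq) (⊕⊝-cancelʳ y c)))
    (filterᵇ⁺-unique P (allVecs-unique n))
    (λ u Pu-c → u ⊝ c , ∈-filterᵇ⁺ P (∈-allVecs (u ⊝ c)) Pu-c , ⊝⊕-cancelʳ u c)
    (λ x x∈ → trans (cong P (⊕⊝-cancelʳ x c)) (proj₂ (∈-filterᵇ⁻ P {allVecs F n} x∈)))

  subspace-size : ∀ {M : Vect F n → Bool} → HasDim F M m → count M (allVecs F n) ≡ q ^ m
  subspace-size {m = m} {M} (_ , bs , in-M , spans , independent) =
    trans (count≡length-of-image M (lincomb F bs) (allVecs F m)
             (lincomb-injective bs independent) (allVecs-unique m)
             (λ v v∈M → let cs , eq = spans v v∈M in cs , ∈-allVecs cs , eq)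
             (λ cs _ → in-M cs))
          (length-allVecs m)

  module SubspacePair {n} {M N : Vect F n → Bool}
    (M-subspace : IsSubspace F M) (N-subspace : IsSubspace F N) where

    private
      module M = Subspace M-subspace
      module N = Subspace N-subspace
      V = allVecs F n

    coset∩coset : Vect F n → Vect F n → Vect F n → Bool
    coset∩coset x y u = M (u ⊝ x) ∧ N (u ⊝ y)

    coset∩coset-size : ∀ {p x y} → p ≈[ M ] x → p ≈[ N ] y →
                       count (coset∩coset x y) V ≡ count (_∩ₛ_ F M N) V
    coset∩coset-size {p} p≈x p≈y =
      trans (count-cong V (λ u _ → cong₂ _∧_ (M.same-coset p≈x u) (N.same-coset p≈y u)))
            (count-translate (_∩ₛ_ F M N) p)

    meeting-size : Vect F n → Vect F n → ℕ
    meeting-size x y = count (coset∩coset x y) V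

    meets : Vect F n → Vect F n → Bool
    meets x y = not (meeting-size x y ≡ᵇ 0)

    meeting-size-dichotomy : ∀ x y →
      meeting-size x y ≡ (if meets x y then count (_∩ₛ_ F M N) V else 0)
    meeting-size-dichotomy x y with meeting-size x y in eq
    ... | zero  = refl
    ... | suc _ with count≢0⇒witness (coset∩coset x y) V (λ eq′ → 0≢1+n (trans (sym eq′) eq))
    ...   | p , _ , p∈ =
      trans (sym eq) (coset∩coset-size (proj₁ (∧≡true⇒ p∈)) (proj₂ (∧≡true⇒ p∈)))

    sum-meeting-size : ∀ x → sum (map (meeting-size x) V) ≡ count N V * count M V
    sum-meeting-size x = begin
      sum (map (λ y → count (λ u → M (u ⊝ x) ∧ N (u ⊝ y)) V) V)
        ≡⟨ sum-swap (λ u y → M (u ⊝ x) ∧ N (u ⊝ y)) V V ⟨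
      sum (map (λ u → count (λ y → M (u ⊝ x) ∧ N (u ⊝ y)) V) V)
        ≡⟨ sum-map-if _ (λ u → M (u ⊝ x)) (count N V) V (λ u _ → fibre u) ⟩
      count N V * count (λ u → M (u ⊝ x)) V
        ≡⟨ cong (count N V *_) (count-translate M x) ⟩
      count N V * count M V ∎
      where
      open ≡-Reasoning
      fibre : ∀ u →
        count (λ y → M (u ⊝ x) ∧ N (u ⊝ y)) V ≡ (if M (u ⊝ x) then count N V else 0)
      fibre u with M (u ⊝ x)
      ... | false = count≡0 _ V (λ _ _ → refl)
      ... | true  = trans (count-cong V (λ y _ → N.⊝-comm-∈ u y)) (count-translate N u)

    cosets-meet : count M V * count N V ≡ count (_∩ₛ_ F M N) V * q ^ n →
                  ∀ x y → ∃ λ p → p ≈[ M ] x × p ≈[ N ] y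
    cosets-meet size-formula x y
      with count≢0⇒witness (coset∩coset x y) V
             (meets⇒≢0 (count≡length⇒ (meets x) all-meet (∈-allVecs y)))
      where
      ∩-nonempty : count (_∩ₛ_ F M N) V ≢ 0
      ∩-nonempty = count≢0 (_∩ₛ_ F M N) (∈-allVecs (0v F))
                           (cong₂ _∧_ (proj₁ M-subspace) (proj₁ N-subspace))
      all-meet : count (meets x) V ≡ length V
      all-meet = *-cancelˡ-≡ _ _ (count (_∩ₛ_ F M N) V) {{≢-nonZero ∩-nonempty}} (begin
        count (_∩ₛ_ F M N) V * count (meets x) V
          ≡⟨ sum-map-if _ (meets x) _ V (λ y _ → meeting-size-dichotomy x y) ⟨
        sum (map (meeting-size x) V)              ≡⟨ sum-meeting-size x ⟩
        count N V * count M V                     ≡⟨ *-comm (count N V) (count M V) ⟩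
        count M V * count N V                     ≡⟨ size-formula ⟩
        count (_∩ₛ_ F M N) V * q ^ n
          ≡⟨ cong (count (_∩ₛ_ F M N) V *_) (length-allVecs n) ⟨
        count (_∩ₛ_ F M N) V * length V           ∎)
        where open ≡-Reasoning
      meets⇒≢0 : ∀ {m} → not (m ≡ᵇ 0) ≡ true → m ≢ 0
      meets⇒≢0 {suc m} _ ()
    ... | p , _ , p∈ = p , ∧≡true⇒ p∈

-- Arithmetic of the dimensions

∸-exponents : ∀ n k → 2 * k ≤ n → (n ∸ k) + (n ∸ k) ≡ (n ∸ 2 * k) + n
∸-exponents _ k 2k≤n with r , refl ← m≤n⇒∃[o]m+o≡n 2k≤n = begin
  (2 * k + r ∸ k) + (2 * k + r ∸ k)
    ≡⟨ cong (λ m → (m ∸ k) + (m ∸ k)) (solve 2 (λ k r → con 2 :* k :+ r := k :+ (k :+ r)) refl k r) ⟩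
  (k + (k + r) ∸ k) + (k + (k + r) ∸ k)
    ≡⟨ cong₂ _+_ (m+n∸m≡n k (k + r)) (m+n∸m≡n k (k + r)) ⟩
  (k + r) + (k + r)
    ≡⟨ solve 2 (λ k r → (k :+ r) :+ (k :+ r) := r :+ (con 2 :* k :+ r)) refl k r ⟩
  r + (2 * k + r)
    ≡⟨ cong (_+ (2 * k + r)) (m+n∸m≡n (2 * k) r) ⟨
  (2 * k + r ∸ 2 * k) + (2 * k + r) ∎
  where
  open ≡-Reasoning
  open +-*-Solver

dimension-formula : ∀ q n k → 2 * k ≤ n → q ^ (n ∸ k) * q ^ (n ∸ k) ≡ q ^ (n ∸ 2 * k) * q ^ n
dimension-formula q n k 2k≤n = begin
  q ^ (n ∸ k) * q ^ (n ∸ k)    ≡⟨ ^-distribˡ-+-* q (n ∸ k) (n ∸ k) ⟨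
  q ^ ((n ∸ k) + (n ∸ k))      ≡⟨ cong (q ^_) (∸-exponents n k 2k≤n) ⟩
  q ^ ((n ∸ 2 * k) + n)        ≡⟨ ^-distribˡ-+-* q (n ∸ 2 * k) n ⟩
  q ^ (n ∸ 2 * k) * q ^ n      ∎
  where open ≡-Reasoning

-- The coset graph

module CosetGraph {q : ℕ} (F : FiniteField q) {n s : ℕ} (Ms : Fin s → Vect F n → Bool)
  (subspace : ∀ i → IsSubspace F (Ms i))
  (2≤s : 2 ≤ s)
  {K₁ K₂ : ℕ}
  (size : ∀ i → count (Ms i) (allVecs F n) ≡ K₁)
  (∩-size : ∀ {i j} → i ≢ j → count (_∩ₛ_ F (Ms i) (Ms j)) (allVecs F n) ≡ K₂)
  (K₁²≡K₂qⁿ : K₁ * K₁ ≡ K₂ * q ^ n)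
  where

  open LinearAlgebra F

  private
    module S {i : Fin s} = Subspace (subspace i)
  open S

  V : List (Vect F n)
  V = allVecs F n

  cosets-meet : ∀ {i j} → i ≢ j → ∀ x y → ∃ λ p → p ≈[ Ms i ] x × p ≈[ Ms j ] y
  cosets-meet {i} {j} i≢j = SubspacePair.cosets-meet (subspace i) (subspace j) (begin
    count (Ms i) V * count (Ms j) V          ≡⟨ cong₂ _*_ (size i) (size j) ⟩
    K₁ * K₁                                  ≡⟨ K₁²≡K₂qⁿ ⟩
    K₂ * q ^ n                               ≡⟨ cong (_* q ^ n) (∩-size i≢j) ⟨
    count (_∩ₛ_ F (Ms i) (Ms j)) V * q ^ n   ∎)
    where open ≡-Reasoning

  coset∩coset-size : ∀ {i j} → i ≢ j → ∀ x y →
                     count (λ u → Ms i (u ⊝ x) ∧ Ms j (u ⊝ y)) V ≡ K₂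
  coset∩coset-size i≢j x y with cosets-meet i≢j x y
  ... | p , p≈x , p≈y =
    trans (SubspacePair.coset∩coset-size (subspace _) (subspace _) p≈x p≈y) (∩-size i≢j)

  inUnion : Vect F n → Bool
  inUnion x = any (λ i → Ms i x) (allFin s)

  inUnion-∈ : ∀ {i x} → Ms i x ≡ true → inUnion x ≡ true
  inUnion-∈ {i} = any-∈ (λ i → Ms i _) (∈-allFin i)

  inUnion⇒ : ∀ {x} → inUnion x ≡ true → ∃ λ i → Ms i x ≡ true
  inUnion⇒ x∈U with any⇒∃ _ (allFin s) x∈U
  ... | i , _ , x∈Mi = i , x∈Mi

  ∉Union⇒ : ∀ {x} → inUnion x ≡ false → ∀ i → Ms i x ≡ false
  ∉Union⇒ x∉U i = any≡false⇒ _ x∉U (∈-allFin i)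

  inUnion-⊝-comm : ∀ u v → inUnion (u ⊝ v) ≡ inUnion (v ⊝ u)
  inUnion-⊝-comm u v = cong or (List.map-cong (λ i → ⊝-comm-∈ u v) (allFin s))

  another : ∀ (i : Fin s) → ∃ λ j → i ≢ j
  another = go 2≤s
    where
    go : ∀ {m} → 2 ≤ m → (i : Fin m) → ∃ λ j → i ≢ j
    go (s≤s (s≤s _)) fzero    = fsuc fzero , λ ()
    go (s≤s (s≤s _)) (fsuc _) = fzero , λ ()

  some-index : Fin s
  some-index = go 2≤s
    where
    go : ∀ {m} → 2 ≤ m → Fin m
    go (s≤s _) = fzero

  G : BipGraph
  G = cosetGraph F n s Ms

  open BipGraph G using (eqV; nbrs)

  _≟ᵥ_ : DecidableEquality (Vect F n)
  _≟ᵥ_ = _≟V_ F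

  coset : Fin s → Vect F n → List (Vect F n)
  coset j c = filterᵇ (λ x → Ms j (x ⊝ c)) V

  nbrs-Y⁻ : ∀ {v u} → u ∈ nbrs (inj₁ v) → ∃ λ j → u ≡ inj₂ (j , v)
  nbrs-Y⁻ u∈ with ∈-map⁻ _ u∈
  ... | j , _ , u≡ = j , u≡

  nbrs-Y⁺ : ∀ v j → inj₂ (j , v) ∈ nbrs (inj₁ v)
  nbrs-Y⁺ v j = ∈-map⁺ _ (∈-allFin j)

  nbrs-Z⁻ : ∀ {j c u} → u ∈ nbrs (inj₂ (j , c)) → ∃ λ x → x ≈[ Ms j ] c × u ≡ inj₁ x
  nbrs-Z⁻ u∈ with ∈-map⁻ inj₁ u∈
  ... | x , x∈ , u≡ = x , proj₂ (∈-filterᵇ⁻ _ {V} x∈) , u≡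

  nbrs-Z⁺ : ∀ {j c x} → x ≈[ Ms j ] c → inj₁ x ∈ nbrs (inj₂ (j , c))
  nbrs-Z⁺ x≈c = ∈-map⁺ inj₁ (∈-filterᵇ⁺ _ (∈-allVecs _) x≈c)

  D : Vtx G → Vtx G → ℕ
  D (inj₁ v)       (inj₁ u)       = if does (v ≟ᵥ u) then 0 else if inUnion (u ⊝ v) then 2 else 4
  D (inj₁ v)       (inj₂ (j , c)) = if Ms j (v ⊝ c) then 1 else 3
  D (inj₂ (i , b)) (inj₁ u)       = if Ms i (u ⊝ b) then 1 else 3
  D (inj₂ (i , b)) (inj₂ (j , c)) = if does (i ≟ᶠ j) then (if Ms i (b ⊝ c) then 0 else 4) else 2

  D≡0 : ∀ a w → eqV a w ≡ does (D a w ≟ 0)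
  D≡0 (inj₁ v) (inj₁ u) with does (v ≟ᵥ u) | inUnion (u ⊝ v)
  ... | true  | _     = refl
  ... | false | true  = refl
  ... | false | false = refl
  D≡0 (inj₁ v) (inj₂ (j , c)) with Ms j (v ⊝ c)
  ... | true  = refl
  ... | false = refl
  D≡0 (inj₂ (i , b)) (inj₁ u) with Ms i (u ⊝ b)
  ... | true  = refl
  ... | false = refl
  D≡0 (inj₂ (i , b)) (inj₂ (j , c)) with does (i ≟ᶠ j) | Ms i (b ⊝ c)
  ... | true  | true  = refl
  ... | true  | false = refl
  ... | false | _     = refl

  private
    1≤4 : 1 ≤ 4
    1≤4 = s≤s z≤n
    2≤4 : 2 ≤ 4
    2≤4 = s≤s (s≤s z≤n)
    3≤4 : 3 ≤ 4
    3≤4 = s≤s (s≤s (s≤s z≤n))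

  D-bounded : ∀ a w → D a w ≤ 4
  D-bounded (inj₁ v) (inj₁ u) =
    if-preserves (_≤ 4) (does (v ≟ᵥ u)) z≤n (if-preserves (_≤ 4) (inUnion (u ⊝ v)) 2≤4 ≤-refl)
  D-bounded (inj₁ v) (inj₂ (j , c)) = if-preserves (_≤ 4) (Ms j (v ⊝ c)) 1≤4 3≤4
  D-bounded (inj₂ (i , b)) (inj₁ u) = if-preserves (_≤ 4) (Ms i (u ⊝ b)) 1≤4 3≤4
  D-bounded (inj₂ (i , b)) (inj₂ (j , c)) =
    if-preserves (_≤ 4) (does (i ≟ᶠ j)) (if-preserves (_≤ 4) (Ms i (b ⊝ c)) z≤n ≤-refl) 2≤4

  side : Vtx G → Parity
  side (inj₁ _) = 0ℙ
  side (inj₂ _) = 1ℙ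

  side-D : ∀ a w → side w ≡ side a ℙ.+ parity (D a w)
  side-D (inj₁ v) (inj₁ u) with does (v ≟ᵥ u) | inUnion (u ⊝ v)
  ... | true  | _     = refl
  ... | false | true  = refl
  ... | false | false = refl
  side-D (inj₁ v) (inj₂ (j , c)) with Ms j (v ⊝ c)
  ... | true  = refl
  ... | false = refl
  side-D (inj₂ (i , b)) (inj₁ u) with Ms i (u ⊝ b)
  ... | true  = refl
  ... | false = refl
  side-D (inj₂ (i , b)) (inj₂ (j , c)) with does (i ≟ᶠ j) | Ms i (b ⊝ c)
  ... | true  | true  = refl
  ... | true  | false = refl
  ... | false | _     = refl

  side-D≡ : ∀ a w {i} → D a w ≡ i → side w ≡ side a ℙ.+ parity i
  side-D≡ a w refl = side-D a w

  D-YY-self : ∀ v → D (inj₁ v) (inj₁ v) ≡ 0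
  D-YY-self v with v ≟ᵥ v
  ... | yes _  = refl
  ... | no v≢v = contradiction refl v≢v

  D-YY-distinct : ∀ {v u} → v ≢ u → D (inj₁ v) (inj₁ u) ≡ (if inUnion (u ⊝ v) then 2 else 4)
  D-YY-distinct {v} {u} v≢u with v ≟ᵥ u
  ... | yes v≡u = contradiction v≡u v≢u
  ... | no _    = refl

  D-ZZ-same : ∀ i b c → D (inj₂ (i , b)) (inj₂ (i , c)) ≡ (if Ms i (b ⊝ c) then 0 else 4)
  D-ZZ-same i b c with i ≟ᶠ i
  ... | yes _  = refl
  ... | no i≢i = contradiction refl i≢i

  D-ZZ-distinct : ∀ {i j} b c → i ≢ j → D (inj₂ (i , b)) (inj₂ (j , c)) ≡ 2
  D-ZZ-distinct {i} {j} b c i≢j with i ≟ᶠ j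
  ... | yes i≡j = contradiction i≡j i≢j
  ... | no _    = refl

  edge : ∀ a {x j c} → x ≈[ Ms j ] c → OneApart (D a (inj₁ x)) (D a (inj₂ (j , c)))
  edge (inj₁ v) {x} {j} {c} x≈c with v ≟ᵥ x
  ... | yes refl rewrite x≈c = inj₂ refl
  ... | no _ with inUnion (x ⊝ v) in x-v∈?U | Ms j (v ⊝ c) in v≈?c
  ...   | true  | true  = inj₁ refl
  ...   | true  | false = inj₂ refl
  ...   | false | false = inj₁ refl
  ...   | false | true  =
    contradiction (trans (sym (inUnion-∈ (≈-trans x≈c (≈-sym v≈?c)))) x-v∈?U) λ ()
  edge (inj₂ (i , b)) {x} {j} {c} x≈c with i ≟ᶠ j
  ... | no _ with Ms i (x ⊝ b)
  ...   | true  = inj₂ refl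
  ...   | false = inj₁ refl
  edge (inj₂ (i , b)) {x} {j} {c} x≈c | yes refl with Ms i (b ⊝ c) in b≈?c
  ...   | true  rewrite ≈-trans x≈c (≈-sym b≈?c) = inj₁ refl
  ...   | false with Ms i (x ⊝ b) in x≈?b
  ...     | false = inj₂ refl
  ...     | true  = contradiction (trans (sym (≈-trans (≈-sym x≈?b) x≈c)) b≈?c) λ ()

  D-step : ∀ a w u → u ∈ nbrs w → OneApart (D a u) (D a w)
  D-step a (inj₁ x) u u∈ with nbrs-Y⁻ u∈
  ... | j , refl = OneApart-sym (edge a (≈-refl x))
  D-step a (inj₂ (j , c)) u u∈ with nbrs-Z⁻ u∈
  ... | x , x≈c , refl = edge a x≈c

  D-descent : ∀ a w → D a w ≢ 0 → ∃ λ u → u ∈ nbrs w × suc (D a u) ≡ D a w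
  D-descent (inj₁ v) (inj₁ u) D≢0 with v ≟ᵥ u
  ... | yes refl = contradiction refl D≢0
  ... | no _ with inUnion (u ⊝ v) in u-v∈?U
  ...   | true with inUnion⇒ u-v∈?U
  ...     | j , u≈v =
    inj₂ (j , u) , nbrs-Y⁺ u j , cong (λ t → suc (if t then 1 else 3)) (≈-sym u≈v)
  D-descent (inj₁ v) (inj₁ u) D≢0 | no _ | false =
    inj₂ (j , u) , nbrs-Y⁺ u j ,
    cong (λ t → suc (if t then 1 else 3)) (trans (⊝-comm-∈ v u) (∉Union⇒ u-v∈?U j))
    where j = some-index
  D-descent (inj₁ v) (inj₂ (j , c)) _ with Ms j (v ⊝ c) in v≈?c
  ... | true = inj₁ v , nbrs-Z⁺ v≈?c , cong suc (D-YY-self v)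
  ... | false with another j
  ...   | i , j≢i with cosets-meet j≢i c v
  ...     | p , p≈c , p≈v =
    inj₁ p , nbrs-Z⁺ p≈c ,
    cong suc (trans (D-YY-distinct v≢p) (cong (λ t → if t then 2 else 4) (inUnion-∈ p≈v)))
    where
    v≢p : v ≢ p
    v≢p refl = contradiction (trans (sym p≈c) v≈?c) λ ()
  D-descent (inj₂ (i , b)) (inj₁ u) _ with Ms i (u ⊝ b) in u≈?b
  ... | true =
    inj₂ (i , u) , nbrs-Y⁺ u i ,
    cong suc (trans (D-ZZ-same i b u) (cong (λ t → if t then 0 else 4) (≈-sym u≈?b)))
  ... | false with another i
  ...   | j , i≢j = inj₂ (j , u) , nbrs-Y⁺ u j , cong suc (D-ZZ-distinct b u i≢j)
  D-descent (inj₂ (i , b)) (inj₂ (j , c)) D≢0 with i ≟ᶠ j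
  ... | yes refl with Ms i (b ⊝ c) in b≈?c
  ...   | true  = contradiction refl D≢0
  ...   | false =
    inj₁ c , nbrs-Z⁺ (≈-refl c) ,
    cong (λ t → suc (if t then 1 else 3)) (trans (⊝-comm-∈ c b) b≈?c)
  D-descent (inj₂ (i , b)) (inj₂ (j , c)) _ | no i≢j with cosets-meet i≢j b c
  ... | p , p≈b , p≈c = inj₁ p , nbrs-Z⁺ p≈c , cong (λ t → suc (if t then 1 else 3)) p≈b

  open DistanceFunction G D D≡0 D-step D-descent

  count-at : Vtx G → ℕ → List (Vtx G) → ℕ
  count-at a i us = count (λ u → does (D a u ≟ i)) us

  degree-on : Parity → ℕ
  degree-on 0ℙ = s
  degree-on 1ℙ = K₁

  deg≡ : ∀ w → deg G w ≡ degree-on (side w)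
  deg≡ (inj₁ u)       = trans (length-map _ (allFin s)) (length-tabulate {n = s} id)
  deg≡ (inj₂ (j , c)) =
    trans (length-map inj₁ (coset j c)) (trans (count-translate (Ms j) c) (size j))

  count-at-4 : ∀ a w → D a w ≡ 4 → count-at a 3 (nbrs w) ≡ degree-on (side a)
  count-at-4 a w at =
    trans (count-at-eccentricity a w (D-bounded a) at)
          (trans (deg≡ w) (cong degree-on (trans (side-D≡ a w at) (ℙ+0ℙ (side a)))))
    where
    ℙ+0ℙ : ∀ p → p ℙ.+ 0ℙ ≡ p
    ℙ+0ℙ 0ℙ = refl
    ℙ+0ℙ 1ℙ = refl

  count-≢ : ∀ i → count (λ j → not (does (i ≟ᶠ j))) (allFin s) ≡ s ∸ 1
  count-≢ i = begin
    #≢                    ≡⟨ m+n∸n≡m #≢ 1 ⟨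
    #≢ + 1 ∸ 1            ≡⟨ cong (λ m → #≢ + m ∸ 1) (count-≟≡1 _≟ᶠ_ (Unique.allFin⁺ s) (∈-allFin i))
                           ⟨
    #≢ + #≡ ∸ 1           ≡⟨ cong (_∸ 1) (count-partition _ _ (allFin s) (λ _ _ → refl)) ⟩
    length (allFin s) ∸ 1 ≡⟨ cong (_∸ 1) (length-tabulate {n = s} id) ⟩
    s ∸ 1                 ∎
    where
    open ≡-Reasoning
    #≢ = count (λ j → not (does (i ≟ᶠ j))) (allFin s)
    #≡ = count (λ j → does (i ≟ᶠ j)) (allFin s)

  module IntersectionArray {d : ℕ} (d≢0 : d ≢ 0)
    (count-0-or-d : ∀ v → v ≢ 0v F → countContaining F Ms v ≡ 0 ⊎ countContaining F Ms v ≡ d)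
    (x₀ : Vect F n) (x₀≢0 : x₀ ≢ 0v F) (x₀-count : countContaining F Ms x₀ ≡ 0)
    where

    countContaining≡ : ∀ {x} → x ≢ 0v F → countContaining F Ms x ≡ (if inUnion x then d else 0)
    countContaining≡ {x} x≢0 with inUnion x in x∈?U
    ... | false = count≡0 _ (allFin s) (λ i _ → ∉Union⇒ x∈?U i)
    ... | true with count-0-or-d x x≢0 | inUnion⇒ x∈?U
    ...   | inj₂ ≡d | _        = ≡d
    ...   | inj₁ ≡0 | i , x∈Mi = contradiction ≡0 (count≢0 _ (∈-allFin i) x∈Mi)

    ⊝≢0 : ∀ {u v : Vect F n} → u ≢ v → u ⊝ v ≢ 0v F
    ⊝≢0 {u} {v} u≢v u-v≡0 = u≢v (⊝≡0⇒≡ u v u-v≡0)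

    x₀∉Union : inUnion x₀ ≡ false
    x₀∉Union = any≡false⇐ _ (allFin s) (λ i i∈ → count≡0⇒ _ x₀-count i∈)

    c₃-at : Vect F n → Fin s → Vect F n → ℕ
    c₃-at v j c = count-at (inj₁ v) 2 (map inj₁ (coset j c))

    d*c₃-at : ∀ {v j c} → Ms j (v ⊝ c) ≡ false → d * c₃-at v j c ≡ K₂ * (s ∸ 1)
    d*c₃-at {v} {j} {c} v≉c = begin
      d * c₃-at v j c
        ≡⟨ cong (d *_) (trans (count-map _ inj₁ (coset j c)) (count-cong (coset j c) at-2)) ⟩
      d * count (λ x → inUnion (x ⊝ v)) (coset j c)
        ≡⟨ sum-map-if _ _ d (coset j c) (λ x x∈ → countContaining≡ (⊝≢0 (≢v x∈))) ⟨
      sum (map (λ x → countContaining F Ms (x ⊝ v)) (coset j c))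
        ≡⟨ sum-swap (λ x i → Ms i (x ⊝ v)) (coset j c) (allFin s) ⟩
      sum (map (λ i → count (λ x → Ms i (x ⊝ v)) (coset j c)) (allFin s))
        ≡⟨ sum-map-if _ (λ i → not (does (j ≟ᶠ i))) K₂ (allFin s) (λ i _ → coset-∩ i) ⟩
      K₂ * count (λ i → not (does (j ≟ᶠ i))) (allFin s)
        ≡⟨ cong (K₂ *_) (count-≢ j) ⟩
      K₂ * (s ∸ 1) ∎
      where
      open ≡-Reasoning
      ≢v : ∀ {x} → x ∈ coset j c → x ≢ v
      ≢v x∈ refl = contradiction (trans (sym (proj₂ (∈-filterᵇ⁻ _ {V} x∈))) v≉c) λ ()
      at-2 : ∀ x → x ∈ coset j c → does (D (inj₁ v) (inj₁ x) ≟ 2) ≡ inUnion (x ⊝ v)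
      at-2 x x∈ = trans (cong (λ m → does (m ≟ 2)) (D-YY-distinct (λ v≡x → ≢v x∈ (sym v≡x))))
                        (if-≟ (inUnion (x ⊝ v)) λ ())
      coset-∩ : ∀ i →
        count (λ x → Ms i (x ⊝ v)) (coset j c) ≡ (if not (does (j ≟ᶠ i)) then K₂ else 0)
      coset-∩ i with j ≟ᶠ i
      ... | no j≢i   = trans (count-filterᵇ _ _ V) (coset∩coset-size j≢i c v)
      ... | yes refl = trans (count-filterᵇ _ _ V) (count≡0 _ V λ x _ → disjoint x)
        where
        disjoint : ∀ x → (Ms j (x ⊝ c) ∧ Ms j (x ⊝ v)) ≡ false
        disjoint x with Ms j (x ⊝ c) in x≈?c | Ms j (x ⊝ v) in x≈?v
        ... | false | _     = refl
        ... | true  | false = refl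
        ... | true  | true  = contradiction (trans (sym (≈-trans (≈-sym x≈?v) x≈?c)) v≉c) λ ()

    -- Any vector and coset at distance 3 would do: by d*c₃-at they all give the same count.
    c₃ : ℕ
    c₃ = c₃-at x₀ some-index (0v F)

    d*c₃ : d * c₃ ≡ K₂ * (s ∸ 1)
    d*c₃ = d*c₃-at (trans (cong (Ms some-index) (⊝-identityʳ x₀)) (∉Union⇒ x₀∉Union some-index))

    c₁-Y : ∀ v w → D (inj₁ v) w ≡ 1 → count-at (inj₁ v) 0 (nbrs w) ≡ 1
    c₁-Y v (inj₁ u) at = contradiction (side-D≡ (inj₁ v) (inj₁ u) at) λ ()
    c₁-Y v (inj₂ (j , c)) at with Ms j (v ⊝ c) in v≈?c
    c₁-Y v (inj₂ (j , c)) () | false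
    ... | true = begin
      count-at (inj₁ v) 0 (map inj₁ (coset j c))
        ≡⟨ count-map _ inj₁ (coset j c) ⟩
      count (λ x → does (D (inj₁ v) (inj₁ x) ≟ 0)) (coset j c)
        ≡⟨ count-cong (coset j c) (λ x _ → D≡0 (inj₁ v) (inj₁ x)) ⟨
      count (λ x → does (v ≟ᵥ x)) (coset j c)
        ≡⟨ count-≟≡1 _≟ᵥ_ (filterᵇ⁺-unique _ (allVecs-unique n))
                          (∈-filterᵇ⁺ _ (∈-allVecs v) v≈?c) ⟩
      1 ∎
      where open ≡-Reasoning

    c₂-Y : ∀ v w → D (inj₁ v) w ≡ 2 → count-at (inj₁ v) 1 (nbrs w) ≡ d
    c₂-Y v (inj₂ (j , c)) at = contradiction (side-D≡ (inj₁ v) (inj₂ (j , c)) at) λ ()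
    c₂-Y v (inj₁ u) at with v ≟ᵥ u | inUnion (u ⊝ v) in u-v∈?U
    c₂-Y v (inj₁ u) () | yes _ | _
    c₂-Y v (inj₁ u) () | no _  | false
    ... | no v≢u | true = begin
      count-at (inj₁ v) 1 (map (λ j → inj₂ (j , u)) (allFin s))
        ≡⟨ count-map _ _ (allFin s) ⟩
      count (λ j → does ((if Ms j (v ⊝ u) then 1 else 3) ≟ 1)) (allFin s)
        ≡⟨ count-cong (allFin s) (λ j _ → if-≟ (Ms j (v ⊝ u)) λ ()) ⟩
      countContaining F Ms (v ⊝ u)
        ≡⟨ countContaining≡ (⊝≢0 v≢u) ⟩
      (if inUnion (v ⊝ u) then d else 0)
        ≡⟨ cong (λ t → if t then d else 0) (trans (inUnion-⊝-comm v u) u-v∈?U) ⟩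
      d ∎
      where open ≡-Reasoning

    c₃-Y : ∀ v w → D (inj₁ v) w ≡ 3 → count-at (inj₁ v) 2 (nbrs w) ≡ c₃
    c₃-Y v (inj₁ u) at = contradiction (side-D≡ (inj₁ v) (inj₁ u) at) λ ()
    c₃-Y v (inj₂ (j , c)) at with Ms j (v ⊝ c) in v≈?c
    c₃-Y v (inj₂ (j , c)) () | true
    ... | false = *-cancelˡ-≡ _ _ d {{≢-nonZero d≢0}} (trans (d*c₃-at v≈?c) (sym d*c₃))

    c₁-Z : ∀ i b w → D (inj₂ (i , b)) w ≡ 1 → count-at (inj₂ (i , b)) 0 (nbrs w) ≡ 1
    c₁-Z i b (inj₂ w) at = contradiction (side-D≡ (inj₂ (i , b)) (inj₂ w) at) λ ()
    c₁-Z i b (inj₁ u) at with Ms i (u ⊝ b) in u≈?b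
    c₁-Z i b (inj₁ u) () | false
    ... | true = begin
      count-at (inj₂ (i , b)) 0 (map (λ j → inj₂ (j , u)) (allFin s))
        ≡⟨ count-map _ _ (allFin s) ⟩
      count (λ j → does (D (inj₂ (i , b)) (inj₂ (j , u)) ≟ 0)) (allFin s)
        ≡⟨ count-cong (allFin s) (λ j _ → sym (D≡0 (inj₂ (i , b)) (inj₂ (j , u)))) ⟩
      count (λ j → does (i ≟ᶠ j) ∧ Ms i (b ⊝ u)) (allFin s)
        ≡⟨ count-cong (allFin s) (λ j _ → trans (cong (does (i ≟ᶠ j) ∧_) (≈-sym u≈?b))
                                                (∧-identityʳ (does (i ≟ᶠ j)))) ⟩
      count (λ j → does (i ≟ᶠ j)) (allFin s)
        ≡⟨ count-≟≡1 _≟ᶠ_ (Unique.allFin⁺ s) (∈-allFin i) ⟩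
      1 ∎
      where open ≡-Reasoning

    c₂-Z : ∀ i b w → D (inj₂ (i , b)) w ≡ 2 → count-at (inj₂ (i , b)) 1 (nbrs w) ≡ K₂
    c₂-Z i b (inj₁ u) at = contradiction (side-D≡ (inj₂ (i , b)) (inj₁ u) at) λ ()
    c₂-Z i b (inj₂ (j , c)) at with i ≟ᶠ j
    c₂-Z i b (inj₂ (j , c)) at | yes refl with Ms i (b ⊝ c)
    c₂-Z i b (inj₂ (j , c)) () | yes refl | true
    c₂-Z i b (inj₂ (j , c)) () | yes refl | false
    c₂-Z i b (inj₂ (j , c)) at | no i≢j = begin
      count-at (inj₂ (i , b)) 1 (map inj₁ (coset j c))
        ≡⟨ count-map _ inj₁ (coset j c) ⟩
      count (λ x → does ((if Ms i (x ⊝ b) then 1 else 3) ≟ 1)) (coset j c)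
        ≡⟨ count-cong (coset j c) (λ x _ → if-≟ (Ms i (x ⊝ b)) λ ()) ⟩
      count (λ x → Ms i (x ⊝ b)) (coset j c)
        ≡⟨ count-filterᵇ _ _ V ⟩
      count (λ x → Ms j (x ⊝ c) ∧ Ms i (x ⊝ b)) V
        ≡⟨ coset∩coset-size (λ j≡i → i≢j (sym j≡i)) c b ⟩
      K₂ ∎
      where open ≡-Reasoning

    c₃-Z : ∀ i b w → D (inj₂ (i , b)) w ≡ 3 → count-at (inj₂ (i , b)) 2 (nbrs w) ≡ s ∸ 1
    c₃-Z i b (inj₂ w) at = contradiction (side-D≡ (inj₂ (i , b)) (inj₂ w) at) λ ()
    c₃-Z i b (inj₁ u) at with Ms i (u ⊝ b) in u≈?b
    c₃-Z i b (inj₁ u) () | true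
    ... | false = begin
      count-at (inj₂ (i , b)) 2 (map (λ j → inj₂ (j , u)) (allFin s))
        ≡⟨ count-map _ _ (allFin s) ⟩
      count (λ j → does (D (inj₂ (i , b)) (inj₂ (j , u)) ≟ 2)) (allFin s)
        ≡⟨ count-cong (allFin s) (λ j _ → at-2 j) ⟩
      count (λ j → not (does (i ≟ᶠ j))) (allFin s)
        ≡⟨ count-≢ i ⟩
      s ∸ 1 ∎
      where
      open ≡-Reasoning
      at-2 : ∀ j → does (D (inj₂ (i , b)) (inj₂ (j , u)) ≟ 2) ≡ not (does (i ≟ᶠ j))
      at-2 j with i ≟ᶠ j
      ... | no _     = refl
      ... | yes refl = cong (λ t → does ((if t then 0 else 4) ≟ 2)) (trans (⊝-comm-∈ b u) u≈?b)

    c-Y : ∀ v w (i : Fin 4) → D (inj₁ v) w ≡ suc (toℕ i) →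
          count-at (inj₁ v) (toℕ i) (nbrs w) ≡ lookup (1 ∷ d ∷ c₃ ∷ s ∷ []) i
    c-Y v w fzero                      = c₁-Y v w
    c-Y v w (fsuc fzero)               = c₂-Y v w
    c-Y v w (fsuc (fsuc fzero))        = c₃-Y v w
    c-Y v w (fsuc (fsuc (fsuc fzero))) = count-at-4 (inj₁ v) w

    c-Z : ∀ z w (i : Fin 4) → D (inj₂ z) w ≡ suc (toℕ i) →
          count-at (inj₂ z) (toℕ i) (nbrs w) ≡ lookup (1 ∷ K₂ ∷ s ∸ 1 ∷ K₁ ∷ []) i
    c-Z (i , b) w fzero                      = c₁-Z i b w
    c-Z (i , b) w (fsuc fzero)               = c₂-Z i b w
    c-Z (i , b) w (fsuc (fsuc fzero))        = c₃-Z i b w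
    c-Z z       w (fsuc (fsuc (fsuc fzero))) = count-at-4 (inj₂ z) w

    farthest-Y : ∀ v → D (inj₁ v) (inj₁ (v ⊕ x₀)) ≡ 4
    farthest-Y v =
      trans (D-YY-distinct v≢v+x₀)
            (cong (λ t → if t then 2 else 4) (trans (cong inUnion (⊕⊝-cancelˡ v x₀)) x₀∉Union))
      where
      v≢v+x₀ : v ≢ v ⊕ x₀
      v≢v+x₀ v≡v+x₀ =
        x₀≢0 (trans (sym (⊕⊝-cancelˡ v x₀)) (trans (cong (_⊝ v) (sym v≡v+x₀)) (⊝-self v)))

    farthest-Z : ∀ z → D (inj₂ z) (inj₂ (proj₁ z , proj₂ z ⊕ x₀)) ≡ 4
    farthest-Z (i , b) = trans (D-ZZ-same i b (b ⊕ x₀)) (cong (λ t → if t then 0 else 4) b≉b+x₀)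
      where
      b≉b+x₀ : Ms i (b ⊝ (b ⊕ x₀)) ≡ false
      b≉b+x₀ =
        trans (⊝-comm-∈ b (b ⊕ x₀))
              (trans (cong (Ms i) (⊕⊝-cancelˡ b x₀)) (∉Union⇒ x₀∉Union i))

    distance-biregular :
      Σ ℕ λ c → d * c ≡ K₂ * (s ∸ 1) ×
        DistanceBiregularWithArray G s (1 ∷ d ∷ c ∷ s ∷ []) K₁ (1 ∷ K₂ ∷ s ∸ 1 ∷ K₁ ∷ [])
    distance-biregular =
        c₃ , d*c₃ , (λ y → deg≡ (inj₁ y)) , (λ z → deg≡ (inj₂ z))
      , partArray inj₁ 4 (1 ∷ d ∷ c₃ ∷ s ∷ []) (λ i → degree-on (parity i))
          (λ v → D-bounded (inj₁ v)) (λ v → inj₁ (v ⊕ x₀) , farthest-Y v)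
          (λ v w → trans (deg≡ w) (cong degree-on (side-D (inj₁ v) w))) c-Y
      , partArray inj₂ 4 (1 ∷ K₂ ∷ s ∸ 1 ∷ K₁ ∷ []) (λ i → degree-on (1ℙ ℙ.+ parity i))
          (λ z → D-bounded (inj₂ z)) (λ z → inj₂ _ , farthest-Z z)
          (λ z w → trans (deg≡ w) (cong degree-on (side-D (inj₂ z) w))) c-Z

theorem5p2 :
  ∀ {q : ℕ} (F : FiniteField q) (n k s d : ℕ) (Ms : Fin s → Vect F n → Bool) →
  1 ≤ k → 2 * k ≤ n → 2 ≤ s → 2 ≤ d →
  (∀ i → HasDim F (Ms i) (n ∸ k)) →
  (∀ i j → i ≢ j → Σ (Vect F n) (λ v → Ms i v ≢ Ms j v)) →
  (∀ v → v ≢ 0v F →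
    (countContaining F Ms v ≡ 0) ⊎ (countContaining F Ms v ≡ d)) →
  Σ (Vect F n) (λ v → v ≢ 0v F × countContaining F Ms v ≡ 0) →
  Σ (Vect F n) (λ v → v ≢ 0v F × countContaining F Ms v ≡ d) →
  (∀ i j → i ≢ j → HasDim F (_∩ₛ_ F (Ms i) (Ms j)) (n ∸ 2 * k)) →
  Σ ℕ (λ c₃ → d * c₃ ≡ q ^ (n ∸ 2 * k) * (s ∸ 1) ×
    DistanceBiregularWithArray (cosetGraph F n s Ms)
      s           (1 ∷ d ∷ c₃ ∷ s ∷ [])
      (q ^ (n ∸ k)) (1 ∷ q ^ (n ∸ 2 * k) ∷ s ∸ 1 ∷ q ^ (n ∸ k) ∷ []))
theorem5p2 {q} F n k s d Ms _ 2k≤n 2≤s 2≤d dim _ count-0-or-d (x₀ , x₀≢0 , x₀-count) _ ∩-dim =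
  IntersectionArray.distance-biregular d≢0 count-0-or-d x₀ x₀≢0 x₀-count
  where
  open LinearAlgebra F using (subspace-size)
  open CosetGraph F Ms (λ i → proj₁ (dim i)) 2≤s
         (λ i → subspace-size (dim i)) (λ {i} {j} i≢j → subspace-size (∩-dim i j i≢j))
         (dimension-formula q n k 2k≤n)
  d≢0 : d ≢ 0
  d≢0 d≡0 with () ← subst (2 ≤_) d≡0 2≤d
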